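{- For every integer $n\ge 3$, let $CL_n$ denote the circular ladder of length $n$. Then $$\chi_\rho(CL_n)=\begin{cases} 5 & \text{if } n=3, \text{ or } n \text{ is even and } n\notin\{8,14\},\\ 7 & \text{if } n\in\{7,8,9\},\\ 6 & \text{otherwise.}\end{cases}$$
   Context: All graphs are simple. For a graph $G$, $d_G(u,v)$ is the number of edges of a shortest path between $u$ and $v$. A packing $k$-colouring of $G$ is a map $\pi:V(G)\to\{1,\dots,k\}$ such that for any two distinct vertices $u,v$, $\pi(u)=\pi(v)=i$ implies $d_G(u,v)>i$. The packing chromatic number $\chi_\rho(G)$ is the smallest $k$ such that $G$ admits a packing $k$-colouring. The circular ladder $CL_n$ ($n\ge 3$) is the Cartesian product $C_n\,\Box\,K_2$: its vertex set is $\{u_0,\dots,u_{n-1}\}\cup\{v_0,\dots,v_{n-1}\}$ and its edges are $u_iv_i$, $u_iu_{i+1}$, $v_iv_{i+1}$ for $0\le i\le n-1$ (subscripts modulo $n$). -}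

module Defs where

open import Data.Nat using (ℕ; _%_; s≤s; z≤n; zero; suc; _+_; _≤_; _<_; _≡ᵇ_)
open import Data.Fin using (Fin; toℕ)
open import Data.Bool using (Bool; not; if_then_else_; _∨_; _∧_)
open import Data.Product using (_×_; _,_; Σ; ∃)
open import Data.Sum using (_⊎_)
open import Relation.Nullary using (¬_)
open import Relation.Binary.PropositionalEquality using (_≡_; refl)
open import Data.Nat.Properties using (m≢1+n+m)
open import Data.Sum using (inj₁; inj₂)

record Graph : Set₁ where
  field
    V      : Set
    Adj    : V → V → Set
    sym    : ∀ {u v} → Adj u v → Adj v u
    irrefl : ∀ {u} → ¬ Adj u u
open Graph public

data Walk (G : Graph) : V G → V G → ℕ → Set where
  here : ∀ {u} → Walk G u u zero
  step : ∀ {u w v k} → Adj G u w → Walk G w v k → Walk G u v (suc k)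

-- d_G(u,v) > i : every walk (hence every shortest path) from u to v has more than i edges.
-- (If u,v are disconnected, d = ∞ and this holds vacuously.)
DistGreater : (G : Graph) → V G → V G → ℕ → Set
DistGreater G u v i = ∀ k → Walk G u v k → i < k

record PackingColouring (G : Graph) (k : ℕ) : Set where
  field
    π       : V G → ℕ
    range   : ∀ v → 1 ≤ π v × π v ≤ k
    packing : ∀ u v → ¬ u ≡ v → π u ≡ π v → DistGreater G u v (π u)

PackingChromaticNumberIs : Graph → ℕ → Set
PackingChromaticNumberIs G m =
  PackingColouring G m × (∀ k → PackingColouring G k → m ≤ k)

-- Circular ladder CL_n = C_n □ K_2 : vertex (i , false) is u_i, (i , true) is v_i.
-- j = i + 1 (mod n)
CycSucc : (n : ℕ) → Fin n → Fin n → Set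
CycSucc n i j = (toℕ j ≡ suc (toℕ i)) ⊎ (suc (toℕ i) ≡ n × toℕ j ≡ 0)

data CLAdj (n : ℕ) : Fin n × Bool → Fin n × Bool → Set where
  rung  : ∀ i b → CLAdj n (i , b) (i , not b)
  fwd   : ∀ i j b → CycSucc n i j → CLAdj n (i , b) (j , b)
  bwd   : ∀ i j b → CycSucc n j i → CLAdj n (i , b) (j , b)

χCL : ℕ → ℕ
χCL n =
  if (n ≡ᵇ 3) ∨ ((n % 2 ≡ᵇ 0) ∧ not ((n ≡ᵇ 8) ∨ (n ≡ᵇ 14))) then 5
  else if (n ≡ᵇ 7) ∨ (n ≡ᵇ 8) ∨ (n ≡ᵇ 9) then 7
  else 6

CLAdj-sym : ∀ {n} {x y} → CLAdj n x y → CLAdj n y x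
CLAdj-sym (rung i Bool.false) = rung i Bool.true
CLAdj-sym (rung i Bool.true)  = rung i Bool.false
CLAdj-sym (fwd i j b p) = bwd j i b p
CLAdj-sym (bwd i j b p) = fwd j i b p

private
  small : ∀ {n k} → 3 ≤ n → suc k ≡ n → ¬ k ≡ 0
  small (s≤s (s≤s (s≤s _))) refl ()

-- Irreflexivity (needs n ≥ 2; we assume n ≥ 3 as in the paper).
CLAdj-irrefl : ∀ {n} → 3 ≤ n → ∀ {x} → ¬ CLAdj n x x
CLAdj-irrefl h {i , b} a = go b a
  where
  go : ∀ b → ¬ CLAdj _ (i , b) (i , b)
  go Bool.false (fwd .i .i _ (inj₁ p)) = m≢1+n+m _ {0} p
  go Bool.false (fwd .i .i _ (inj₂ (p , q))) = small h p q
  go Bool.false (bwd .i .i _ (inj₁ p)) = m≢1+n+m _ {0} p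
  go Bool.false (bwd .i .i _ (inj₂ (p , q))) = small h p q
  go Bool.true (fwd .i .i _ (inj₁ p)) = m≢1+n+m _ {0} p
  go Bool.true (fwd .i .i _ (inj₂ (p , q))) = small h p q
  go Bool.true (bwd .i .i _ (inj₁ p)) = m≢1+n+m _ {0} p
  go Bool.true (bwd .i .i _ (inj₂ (p , q))) = small h p q

CL : (n : ℕ) → 3 ≤ n → Graph
CL n h = record
  { V = Fin n × Bool
  ; Adj = CLAdj n
  ; sym = CLAdj-sym
  ; irrefl = CLAdj-irrefl h
  }

module Submission where

-- Read a packing colouring of CL_n column by column: it becomes a cyclic sequence of pairs of
-- colours in which equal colours are far apart.  The lower bounds are exhaustive searches over
-- such sequences: six consecutive columns never admit 4 colours; with 5 colours the row holding
-- colour 1 (else 2, else 5) alternates from column to column, so n must be even; the small and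
-- exceptional cases are settled by searching entire cycles, started at a vertex of the top colour.
-- The upper bounds are explicit words of columns, for most n a block of six columns repeated k
-- times and followed by a tail chosen by n mod 6; such a word is checked once and for all on the
-- windows of block ++ block and block ++ tail ++ block.

open import Defs hiding (sym)
open import Data.Bool using (Bool; true; false; not; _∧_; _∨_; _xor_; if_then_else_)
open import Data.Bool.ListAction using (all)
open import Data.Bool.Properties using (not-involutive; not-¬; T-≡)
open import Data.Empty using (⊥-elim)
open import Data.Fin using (Fin; toℕ; fromℕ<)
open import Data.Fin.Properties using (toℕ-injective; toℕ<n; toℕ-fromℕ<; any?)
open import Data.List using (List; []; _∷_; _++_; length; applyUpTo)
open import Data.List.Properties using (length-++; ++-assoc)
open import Data.List.Relation.Unary.All using (All; _∷_; all?)
open import Data.List.Relation.Unary.All.Properties using (applyUpTo⁻; all⁺; ++⁺; ++⁻ˡ; ++⁻ʳ)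
open import Data.Nat
  using (ℕ; zero; suc; pred; _+_; _*_; _∸_; _≤_; _<_; s≤s; z≤n; z<s; s<s; _%_; _/_; _≡ᵇ_; _<ᵇ_; NonZero)
open import Data.Nat.DivMod
open import Data.Nat.GeneralisedArithmetic using (fold)
open import Data.Nat.Properties
open import Data.Product using (_×_; _,_; proj₁; proj₂; ∃-syntax)
open import Data.Sum using (_⊎_; inj₁; inj₂)
open import Function using (_∘_; Equivalence)
open import Relation.Binary.PropositionalEquality
open import Relation.Nullary using (¬_; Dec; yes; no; ¬?)
open import Relation.Nullary.Decidable using (map′; _×-dec_; _→-dec_; _⊎-dec_; True; toWitness)

-- Distances in the ladder

module Cycle (N : ℕ) .{{_ : NonZero N}} where

  next : Fin N → Fin N
  next i = fromℕ< (m%n<n (suc (toℕ i)) N)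

  shift : Fin N → ℕ → Fin N
  shift i zero    = i
  shift i (suc t) = shift (next i) t

  [m%N+t]%N≡[m+t]%N : ∀ m t → (m % N + t) % N ≡ (m + t) % N
  [m%N+t]%N≡[m+t]%N m t = begin
    (m % N + t) % N           ≡⟨ %-distribˡ-+ (m % N) t N ⟩
    (m % N % N + t % N) % N   ≡⟨ cong (λ k → (k + t % N) % N) (m%n%n≡m%n m N) ⟩
    (m % N + t % N) % N       ≡⟨ %-distribˡ-+ m t N ⟨
    (m + t) % N               ∎
    where open ≡-Reasoning

  toℕ-shift : ∀ i t → toℕ (shift i t) ≡ (toℕ i + t) % N
  toℕ-shift i zero    = sym (trans (cong (_% N) (+-identityʳ (toℕ i))) (m<n⇒m%n≡m (toℕ<n i)))
  toℕ-shift i (suc t) = begin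
    toℕ (shift (next i) t)       ≡⟨ toℕ-shift (next i) t ⟩
    (toℕ (next i) + t) % N       ≡⟨ cong (λ k → (k + t) % N) (toℕ-fromℕ< _) ⟩
    (suc (toℕ i) % N + t) % N    ≡⟨ [m%N+t]%N≡[m+t]%N (suc (toℕ i)) t ⟩
    (suc (toℕ i) + t) % N        ≡⟨ cong (_% N) (+-suc (toℕ i) t) ⟨
    (toℕ i + suc t) % N          ∎
    where open ≡-Reasoning

  shift-+ : ∀ i s t → shift i (s + t) ≡ shift (shift i s) t
  shift-+ i zero    t = refl
  shift-+ i (suc s) t = shift-+ (next i) s t

  shift-suc : ∀ i t → shift i (suc t) ≡ next (shift i t)
  shift-suc i t = trans (cong (shift i) (+-comm 1 t)) (shift-+ i t 1)

  shift-% : ∀ i t → shift i (t % N) ≡ shift i t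
  shift-% i t = toℕ-injective (begin
    toℕ (shift i (t % N))    ≡⟨ toℕ-shift i (t % N) ⟩
    (toℕ i + t % N) % N      ≡⟨ cong (_% N) (+-comm (toℕ i) (t % N)) ⟩
    (t % N + toℕ i) % N      ≡⟨ [m%N+t]%N≡[m+t]%N t (toℕ i) ⟩
    (t + toℕ i) % N          ≡⟨ cong (_% N) (+-comm t (toℕ i)) ⟩
    (toℕ i + t) % N          ≡⟨ toℕ-shift i t ⟨
    toℕ (shift i t)          ∎)
    where open ≡-Reasoning

  shift-N : ∀ i → shift i N ≡ i
  shift-N i = trans (sym (shift-% i N)) (cong (shift i) (n%n≡0 N))

  shift-≢ : ∀ i {d} → 0 < d → d < N → shift i d ≢ i
  shift-≢ i {d} 0<d d<N eq = wraps (trans (sym (toℕ-shift i d)) (cong toℕ eq))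
    where
    wraps : (toℕ i + d) % N ≢ toℕ i
    wraps i+d≡i with toℕ i + d <? N
    ... | yes i+d<N = <-irrefl (trans (sym i+d≡i) (m<n⇒m%n≡m i+d<N)) (m<m+n (toℕ i) 0<d)
    ... | no  i+d≮N = <⇒≱ r<i i≤r
      where
        N≤i+d : N ≤ toℕ i + d
        N≤i+d = ≮⇒≥ i+d≮N
        r : ℕ
        r = toℕ i + d ∸ N
        r<i : r < toℕ i
        r<i = +-cancelʳ-< N r (toℕ i) (subst (_< toℕ i + N) (sym (m∸n+n≡m N≤i+d)) (+-monoʳ-< (toℕ i) d<N))
        i≤r : toℕ i ≤ r
        i≤r = subst (_≤ r) (trans (m≤n⇒[n∸m]%m≡n%m N≤i+d) i+d≡i) (m%n≤m r N)

m+n≤k⇒m+1+n≤1+k : ∀ {m n k} → m + n ≤ k → m + suc n ≤ suc k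
m+n≤k⇒m+1+n≤1+k {m} {n} {k} le = subst (_≤ suc k) (sym (+-suc m n)) (s≤s le)

m+1+n≤k⇒m+n≤1+k : ∀ {m n k} → m + suc n ≤ k → m + n ≤ suc k
m+1+n≤k⇒m+n≤1+k {m} {n} le = ≤-trans (+-monoʳ-≤ m (n≤1+n n)) (m≤n⇒m≤1+n le)

module Ladder (N : ℕ) .{{_ : NonZero N}} (h : 3 ≤ N) where
  open Cycle N

  next-cycSucc : ∀ i → CycSucc N i (next i)
  next-cycSucc i with suc (toℕ i) <? N
  ... | yes 1+i<N = inj₁ (trans (toℕ-fromℕ< _) (m<n⇒m%n≡m 1+i<N))
  ... | no  1+i≮N = inj₂ (1+i≡N , trans (toℕ-fromℕ< _) (trans (cong (_% N) 1+i≡N) (n%n≡0 N)))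
    where
    1+i≡N : suc (toℕ i) ≡ N
    1+i≡N = ≤-antisym (toℕ<n i) (≮⇒≥ 1+i≮N)

  cycSucc-injectiveˡ : ∀ {i i′ j} → CycSucc N i j → CycSucc N i′ j → i ≡ i′
  cycSucc-injectiveˡ (inj₁ e)       (inj₁ e′)       = toℕ-injective (suc-injective (trans (sym e) e′))
  cycSucc-injectiveˡ (inj₁ e)       (inj₂ (_ , e′)) with () ← trans (sym e) e′
  cycSucc-injectiveˡ (inj₂ (_ , e)) (inj₁ e′)       with () ← trans (sym e) e′
  cycSucc-injectiveˡ (inj₂ (e , _)) (inj₂ (e′ , _)) = toℕ-injective (suc-injective (trans e (sym e′)))

  cycSucc-injectiveʳ : ∀ {i j j′} → CycSucc N i j → CycSucc N i j′ → j ≡ j′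
  cycSucc-injectiveʳ (inj₁ e)           (inj₁ e′)           = toℕ-injective (trans e (sym e′))
  cycSucc-injectiveʳ {j = j} (inj₁ e)    (inj₂ (1+i≡N , _))  = ⊥-elim (<-irrefl (trans e 1+i≡N) (toℕ<n j))
  cycSucc-injectiveʳ {j′ = j′} (inj₂ (1+i≡N , _)) (inj₁ e′) = ⊥-elim (<-irrefl (trans e′ 1+i≡N) (toℕ<n j′))
  cycSucc-injectiveʳ (inj₂ (_ , e))     (inj₂ (_ , e′))     = toℕ-injective (trans e (sym e′))

  cycSucc⇒≡next : ∀ {i j} → CycSucc N i j → j ≡ next i
  cycSucc⇒≡next {i} s = cycSucc-injectiveʳ s (next-cycSucc i)

  next-injective : ∀ {i i′} → next i ≡ next i′ → i ≡ i′
  next-injective {i} {i′} e = cycSucc-injectiveˡ (next-cycSucc i) (subst (CycSucc N i′) (sym e) (next-cycSucc i′))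

  walk-along : ∀ i t b → Walk (CL N h) (i , b) (shift i t , b) t
  walk-along i zero    b = here
  walk-along i (suc t) b = step (fwd i (next i) b (next-cycSucc i)) (walk-along (next i) t b)

  walk-across : ∀ i t b → Walk (CL N h) (i , b) (shift i t , not b) (suc t)
  walk-across i t b = step (rung i b) (walk-along i t (not b))

  rowDist : Bool → Bool → ℕ
  rowDist false false = 0
  rowDist true  true  = 0
  rowDist false true  = 1
  rowDist true  false = 1

  rowDist-sym : ∀ b c → rowDist b c ≡ rowDist c b
  rowDist-sym false false = refl
  rowDist-sym false true  = refl
  rowDist-sym true  false = refl
  rowDist-sym true  true  = refl

  rowDist-not : ∀ b c → rowDist b c ≤ suc (rowDist (not b) c)
  rowDist-not false false = z≤n
  rowDist-not false true  = s≤s z≤n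
  rowDist-not true  false = s≤s z≤n
  rowDist-not true  true  = z≤n

  Offset : Fin N → Bool → Fin N → Bool → ℕ → Set
  Offset i b j c k = ∃[ t ] rowDist b c + t ≤ k × (shift i t ≡ j ⊎ shift j t ≡ i)

  walk⇒offset : ∀ {i b j c k} → Walk (CL N h) (i , b) (j , c) k → Offset i b j c k
  walk⇒offset {b = false} here = 0 , z≤n , inj₁ refl
  walk⇒offset {b = true}  here = 0 , z≤n , inj₁ refl
  walk⇒offset {i} {b} {c = c} (step (rung .i .b) w) with walk⇒offset w
  ... | t , d≤k , p = t , ≤-trans (+-monoˡ-≤ t (rowDist-not b c)) (s≤s d≤k) , p
  walk⇒offset {i} {b} {j} {c} (step (fwd .i i′ .b s) w) with refl ← cycSucc⇒≡next s | walk⇒offset w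
  ... | t     , d≤k , inj₁ p = suc t , m+n≤k⇒m+1+n≤1+k d≤k , inj₁ p
  ... | zero  , d≤k , inj₂ p = 1 , m+n≤k⇒m+1+n≤1+k d≤k , inj₁ (sym p)
  ... | suc t , d≤k , inj₂ p = t , m+1+n≤k⇒m+n≤1+k d≤k , inj₂ (next-injective (trans (sym (shift-suc j t)) p))
  walk⇒offset {i} {b} {j} {c} (step (bwd .i i′ .b s) w) with refl ← cycSucc⇒≡next s | walk⇒offset w
  ... | zero  , d≤k , inj₁ p = 1 , m+n≤k⇒m+1+n≤1+k d≤k , inj₂ (cong next (sym p))
  ... | suc t , d≤k , inj₁ p = t , m+1+n≤k⇒m+n≤1+k d≤k , inj₁ p
  ... | t     , d≤k , inj₂ p = suc t , m+n≤k⇒m+1+n≤1+k d≤k , inj₂ (trans (shift-suc j t) (cong next p))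

Column : Set
Column = ℕ × ℕ

-- Constraints between two columns at horizontal distance d: vertices in the same row are d apart,
-- vertices in different rows d + 1 apart.
ColumnsApart : ℕ → Column → Column → Set
ColumnsApart d (a , b) (a′ , b′) =
  (a ≡ a′ → a < d) × (b ≡ b′ → b < d) × (a ≡ b′ → a < suc d) × (b ≡ a′ → b < suc d)

columnsApart? : ∀ d c c′ → Dec (ColumnsApart d c c′)
columnsApart? d (a , b) (a′ , b′) =
  (a ≟ a′ →-dec a <? d) ×-dec (b ≟ b′ →-dec b <? d) ×-dec
  (a ≟ b′ →-dec a <? suc d) ×-dec (b ≟ a′ →-dec b <? suc d)

columnsApart-sym : ∀ {d c c′} → ColumnsApart d c c′ → ColumnsApart d c′ c
columnsApart-sym {d} (aa , bb , ab , ba) =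
    (λ e → subst (_< d) (sym e) (aa (sym e)))
  , (λ e → subst (_< d) (sym e) (bb (sym e)))
  , (λ e → subst (_< suc d) (sym e) (ba (sym e)))
  , (λ e → subst (_< suc d) (sym e) (ab (sym e)))

ProperColumn : ℕ → Column → Set
ProperColumn K (a , b) = (1 ≤ a × a ≤ K) × (1 ≤ b × b ≤ K) × a ≢ b

properColumn? : ∀ K c → Dec (ProperColumn K c)
properColumn? K (a , b) = (1 ≤? a ×-dec a ≤? K) ×-dec (1 ≤? b ×-dec b ≤? K) ×-dec ¬? (a ≟ b)

infixr 5 _⇒ᵇ_

_⇒ᵇ_ : Bool → Bool → Bool
x ⇒ᵇ y = not x ∨ y

⇒ᵇ-elim : ∀ {x y} → x ⇒ᵇ y ≡ true → x ≡ true → y ≡ true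
⇒ᵇ-elim x⇒y refl = x⇒y

∧-intro : ∀ {x y} → x ≡ true → y ≡ true → x ∧ y ≡ true
∧-intro refl refl = refl

≡ᵇ⇒ᵇ-intro : ∀ m n {y} → (m ≡ n → y ≡ true) → (m ≡ᵇ n) ⇒ᵇ y ≡ true
≡ᵇ⇒ᵇ-intro m n k with m ≡ᵇ n in eq
... | false = refl
... | true  = k (≡ᵇ⇒≡ m n (Equivalence.from T-≡ eq))

≡ᵇ⇒ᵇ-elim : ∀ m n {y} → (m ≡ᵇ n) ⇒ᵇ y ≡ true → m ≡ n → y ≡ true
≡ᵇ⇒ᵇ-elim m .m m⇒y refl = ⇒ᵇ-elim m⇒y (Equivalence.to T-≡ (≡⇒≡ᵇ m m refl))

<ᵇ-complete : ∀ {m n} → m < n → (m <ᵇ n) ≡ true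
<ᵇ-complete z<s               = refl
<ᵇ-complete (s<s m<n@(s≤s _)) = <ᵇ-complete m<n

-- The searches below run on this boolean twin of columnsApart?, which evaluates much faster
-- during type checking; they only need its completeness.
columnsApartᵇ : ℕ → Column → Column → Bool
columnsApartᵇ d (a , b) (a′ , b′) =
  ((a ≡ᵇ a′) ⇒ᵇ (a <ᵇ d)) ∧ ((b ≡ᵇ b′) ⇒ᵇ (b <ᵇ d)) ∧
  ((a ≡ᵇ b′) ⇒ᵇ (a <ᵇ suc d)) ∧ ((b ≡ᵇ a′) ⇒ᵇ (b <ᵇ suc d))

columnsApartᵇ-complete : ∀ {d c c′} → ColumnsApart d c c′ → columnsApartᵇ d c c′ ≡ true
columnsApartᵇ-complete {d} {a , b} {a′ , b′} (aa , bb , ab , ba) =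
  ∧-intro (≡ᵇ⇒ᵇ-intro a a′ (<ᵇ-complete ∘ aa)) (∧-intro (≡ᵇ⇒ᵇ-intro b b′ (<ᵇ-complete ∘ bb))
    (∧-intro (≡ᵇ⇒ᵇ-intro a b′ (<ᵇ-complete ∘ ab)) (≡ᵇ⇒ᵇ-intro b a′ (<ᵇ-complete ∘ ba))))

distinctᵇ : Column → Bool
distinctᵇ (a , b) = (a ≡ᵇ b) ⇒ᵇ false

distinctᵇ-complete : ∀ {K c} → ProperColumn K c → distinctᵇ c ≡ true
distinctᵇ-complete {c = a , b} (_ , _ , a≢b) = ≡ᵇ⇒ᵇ-intro a b (⊥-elim ∘ a≢b)

-- Lower bounds by exhaustive search

-- A search state lists the columns chosen so far, most recent first, so that fitsAfter d cs c
-- compares the new column c with the column d places back, then d + 1 places back, and so on.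
module Search (K : ℕ) (apartᵇ : ℕ → Column → Column → Bool) where

  colours : List ℕ
  colours = applyUpTo suc K

  forEachColumn : (Column → Bool) → Bool
  forEachColumn p = all (λ a → all (λ b → p (a , b)) colours) colours

  forEachColumn-sound : ∀ {p c} → forEachColumn p ≡ true → ProperColumn K c → p c ≡ true
  forEachColumn-sound {p} {suc a , suc b} all-p ((_ , a<K) , (_ , b<K) , _) =
    Equivalence.to T-≡ (applyUpTo⁻ suc K (all⁺ (λ b → p (suc a , b)) _ row-a) b<K)
    where
    row-a = applyUpTo⁻ suc K (all⁺ _ _ (Equivalence.from T-≡ all-p)) a<K

  fitsAfter : ℕ → List Column → Column → Bool
  fitsAfter d []        c = true
  fitsAfter d (c′ ∷ cs) c = apartᵇ d c′ c ∧ fitsAfter (suc d) cs c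

  allExtensions : (List Column → Bool) → ℕ → List Column → Bool
  allExtensions P zero    cs = P cs
  allExtensions P (suc n) cs =
    forEachColumn λ c → distinctᵇ c ⇒ᵇ fitsAfter 1 cs c ⇒ᵇ allExtensions P n (c ∷ cs)

  history : (ℕ → Column) → ℕ → List Column
  history f zero    = []
  history f (suc p) = f p ∷ history f p

  record Admissible (L : ℕ) (f : ℕ → Column) : Set where
    field
      proper : ∀ {q} → q < L → ProperColumn K (f q)
      apart  : ∀ {j} d → 0 < d → d + j < L → apartᵇ d (f j) (f (d + j)) ≡ true

  module _ {L f} (adm : Admissible L f) where
    open Admissible adm

    fitsAfter-history : ∀ p d → d + p < L → fitsAfter (suc d) (history f p) (f (d + p)) ≡ true
    fitsAfter-history zero    d _  = refl
    fitsAfter-history (suc p) d lt rewrite +-suc d p =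
      ∧-intro (apart (suc d) (s≤s z≤n) lt) (fitsAfter-history p (suc d) lt)

    allExtensions-sound : ∀ P p n → p + n ≤ L →
      allExtensions P n (history f p) ≡ true → P (history f (p + n)) ≡ true
    allExtensions-sound P p zero    _  ext = subst (λ q → P (history f q) ≡ true) (sym (+-identityʳ p)) ext
    allExtensions-sound P p (suc n) le ext =
      subst (λ q → P (history f q) ≡ true) (sym (+-suc p n))
        (allExtensions-sound P (suc p) n (subst (_≤ L) (+-suc p n) le)
          (⇒ᵇ-elim (⇒ᵇ-elim (forEachColumn-sound ext (proper p<L)) (distinctᵇ-complete (proper p<L)))
            (fitsAfter-history p 0 p<L)))
      where
      p<L : p < L
      p<L = <-≤-trans (m<m+n p (s≤s z≤n)) le

module Linear (K : ℕ) = Search K columnsApartᵇ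
module Cyclic (N K : ℕ) = Search K (λ d c c′ → columnsApartᵇ d c c′ ∧ columnsApartᵇ (N ∸ d) c c′)

module ColumnsOf {N} .{{_ : NonZero N}} (h : 3 ≤ N) {K} (κ : PackingColouring (CL N h) K) where
  open PackingColouring κ
  open Cycle N
  open Ladder N h

  column : Bool → Fin N → Column
  column b i = π (i , b) , π (i , not b)

  column-proper : ∀ b i → ProperColumn K (column b i)
  column-proper b i = range (i , b) , range (i , not b) , λ e →
    <⇒≱ (packing _ _ (not-¬ refl ∘ cong proj₂) e 1 (step (rung i b) here)) (proj₁ (range (i , b)))

  columnsApart-of-walks : ∀ {i j d} → i ≢ j →
    (∀ b → Walk (CL N h) (i , b) (j , b) d) → (∀ b → Walk (CL N h) (i , b) (j , not b) (suc d)) →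
    ∀ b → ColumnsApart d (column b i) (column b j)
  columnsApart-of-walks {i} {j} {d} i≢j along across b =
      (λ e → packing _ _ apart e _ (along b))
    , (λ e → packing _ _ apart e _ (along (not b)))
    , (λ e → packing _ _ apart e _ (across b))
    , (λ e → packing _ _ apart e _
                 (subst (λ c → Walk (CL N h) (i , not b) (j , c) (suc d)) (not-involutive b) (across (not b))))
    where
    apart : ∀ {b c} → (i , b) ≢ (j , c)
    apart = i≢j ∘ cong proj₁

  column-apart : ∀ b i {d} → 0 < d → d < N → ColumnsApart d (column b i) (column b (shift i d))
  column-apart b i 0<d d<N =
    columnsApart-of-walks (≢-sym (shift-≢ i 0<d d<N)) (walk-along i _) (walk-across i _) b

  column-apart-around : ∀ b i {d} → 0 < d → d < N → ColumnsApart (N ∸ d) (column b i) (column b (shift i d))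
  column-apart-around b i {d} 0<d d<N =
    columnsApart-sym (columnsApart-of-walks (shift-≢ i 0<d d<N) along across b)
    where
    back : shift (shift i d) (N ∸ d) ≡ i
    back = trans (sym (shift-+ i d (N ∸ d))) (trans (cong (shift i) (m+[n∸m]≡n (<⇒≤ d<N))) (shift-N i))
    along : ∀ c → Walk (CL N h) (shift i d , c) (i , c) (N ∸ d)
    along c = subst (λ k → Walk (CL N h) (shift i d , c) (k , c) (N ∸ d)) back
                (walk-along (shift i d) (N ∸ d) c)
    across : ∀ c → Walk (CL N h) (shift i d , c) (i , not c) (suc (N ∸ d))
    across c = subst (λ k → Walk (CL N h) (shift i d , c) (k , not c) (suc (N ∸ d))) back
                 (walk-across (shift i d) (N ∸ d) c)

  columnsFrom : Fin N → Bool → ℕ → Column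
  columnsFrom r b q = column b (shift r q)

  columnsFrom-apart : ∀ r b {j} d → 0 < d → d < N →
    ColumnsApart d (columnsFrom r b j) (columnsFrom r b (d + j)) ×
    ColumnsApart (N ∸ d) (columnsFrom r b j) (columnsFrom r b (d + j))
  columnsFrom-apart r b {j} d 0<d d<N rewrite +-comm d j | shift-+ r j d =
    column-apart b (shift r j) 0<d d<N , column-apart-around b (shift r j) 0<d d<N

  window-admissible : ∀ {L} → L ≤ N → ∀ r b → Linear.Admissible K L (columnsFrom r b)
  window-admissible L≤N r b = record
    { proper = λ _ → column-proper b _
    ; apart  = λ {j} d 0<d lt →
        columnsApartᵇ-complete (proj₁ (columnsFrom-apart r b d 0<d (<-≤-trans (m+n≤o⇒m≤o (suc d) lt) L≤N))) }

  cycle-admissible : ∀ r b → Cyclic.Admissible N K N (columnsFrom r b)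
  cycle-admissible r b = record
    { proper = λ _ → column-proper b _
    ; apart  = λ {j} d 0<d lt →
        let near , around = columnsFrom-apart r b d 0<d (m+n≤o⇒m≤o (suc d) lt)
        in  ∧-intro (columnsApartᵇ-complete near) (columnsApartᵇ-complete around) }

origin : ∀ {N} → 3 ≤ N → Fin N
origin h = fromℕ< (≤-trans (s≤s z≤n) h)

without-colour : ∀ {G K} (κ : PackingColouring G (suc K)) →
  (∀ v → PackingColouring.π κ v ≢ suc K) → PackingColouring G K
without-colour κ absent = record
  { π       = π
  ; range   = λ v → proj₁ (range v) , ≤-pred (≤∧≢⇒< (proj₂ (range v)) (absent v))
  ; packing = packing }
  where open PackingColouring κ

xor-true⇒≡not : ∀ {x y} → x xor y ≡ true → x ≡ not y
xor-true⇒≡not {true}  {false} _  = refl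
xor-true⇒≡not {false} {true}  _  = refl
xor-true⇒≡not {true}  {true}  ()
xor-true⇒≡not {false} {false} ()

-- In a window of six columns, the middle two must have opposite phases.
alternates : (Column → Bool) → List Column → Bool
alternates phase (_ ∷ _ ∷ c₃ ∷ c₂ ∷ _) = phase c₃ xor phase c₂
alternates phase _                    = false

colour-used? : ∀ {N h K} (κ : PackingColouring (CL N h) K) c → Dec (∃[ v ] PackingColouring.π κ v ≡ c)
colour-used? κ c = map′
  (λ { (i , inj₁ e) → (i , false) , e ; (i , inj₂ e) → (i , true) , e })
  (λ { ((i , false) , e) → i , inj₁ e ; ((i , true) , e) → i , inj₂ e })
  (any? λ i → (π (i , false) ≟ c) ⊎-dec (π (i , true) ≟ c))
  where open PackingColouring κ

topColourStarts : ℕ → ℕ → Bool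
topColourStarts N K = Cyclic.forEachColumn N K λ c →
  (proj₁ c ≡ᵇ K) ⇒ᵇ distinctᵇ c ⇒ᵇ Cyclic.allExtensions N K (λ _ → false) (pred N) (c ∷ [])

module _ {N} .{{_ : NonZero N}} (h : 3 ≤ N) {K : ℕ} where
  open Cycle N

  cycle-obstruction : Cyclic.allExtensions N K (λ _ → false) N [] ≡ true → ¬ PackingColouring (CL N h) K
  cycle-obstruction none κ with () ←
    Cyclic.allExtensions-sound N K (ColumnsOf.cycle-admissible h κ (origin h) false) (λ _ → false) 0 N ≤-refl none

  window-obstruction : ∀ {L} → L ≤ N →
    Linear.allExtensions K (λ _ → false) L [] ≡ true → ¬ PackingColouring (CL N h) K
  window-obstruction L≤N none κ with () ←
    Linear.allExtensions-sound K (ColumnsOf.window-admissible h κ L≤N (origin h) false) (λ _ → false) 0 _ ≤-refl none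

  -- If the top colour occurs, read the columns starting from a vertex that has it.
  top-colour-obstruction : topColourStarts N (suc K) ≡ true →
    ¬ PackingColouring (CL N h) K → ¬ PackingColouring (CL N h) (suc K)
  top-colour-obstruction none ¬κ κ with colour-used? {h = h} κ (suc K)
  ... | no  unused          = ¬κ (without-colour κ λ v e → unused (v , e))
  ... | yes ((r , b) , top) with () ←
    Cyclic.allExtensions-sound N (suc K) (ColumnsOf.cycle-admissible h κ r b) (λ _ → false) 1 (pred N)
      (≤-reflexive (suc-pred N))
      (⇒ᵇ-elim (≡ᵇ⇒ᵇ-elim _ _ (Cyclic.forEachColumn-sound N (suc K) none (ColumnsOf.column-proper h κ b r)) top)
        (distinctᵇ-complete (ColumnsOf.column-proper h κ b r)))

  parity-obstruction : (phase : Column → Bool) → 6 ≤ N → N % 2 ≡ 1 →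
    Linear.allExtensions K (alternates phase) 6 [] ≡ true → ¬ PackingColouring (CL N h) K
  parity-obstruction phase 6≤N odd alternating κ = not-¬ refl (begin
    phaseAt r                         ≡⟨ cong phaseAt (shift-N r) ⟨
    phaseAt (shift r N)               ≡⟨ cong (phaseAt ∘ shift r) N≡1+m*2 ⟩
    phaseAt (shift (next r) (m * 2))  ≡⟨ phaseAt-even m (next r) ⟩
    phaseAt (next r)                  ≡⟨ flips r ⟩
    not (phaseAt r)                   ∎)
    where
    open ColumnsOf h κ
    open ≡-Reasoning
    r = origin h
    m = N / 2
    phaseAt : Fin N → Bool
    phaseAt s = phase (column false (shift s 2))
    flips : ∀ s → phaseAt (next s) ≡ not (phaseAt s)
    flips s = xor-true⇒≡not
      (Linear.allExtensions-sound K (window-admissible 6≤N s false) (alternates phase) 0 6 ≤-refl alternating)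
    phaseAt-even : ∀ k s → phaseAt (shift s (k * 2)) ≡ phaseAt s
    phaseAt-even zero    s = refl
    phaseAt-even (suc k) s = begin
      phaseAt (shift (next (next s)) (k * 2)) ≡⟨ phaseAt-even k (next (next s)) ⟩
      phaseAt (next (next s))                 ≡⟨ flips (next s) ⟩
      not (phaseAt (next s))                  ≡⟨ cong not (flips s) ⟩
      not (not (phaseAt s))                   ≡⟨ not-involutive _ ⟩
      phaseAt s                               ∎
    N≡1+m*2 : N ≡ 1 + m * 2
    N≡1+m*2 = trans (m≡m%n+[m/n]*n N 2) (cong (_+ m * 2) odd)

-- Upper bounds from words of columns

entry : Column → Bool → ℕ
entry (a , _) false = a
entry (_ , b) true  = b

proper-entries-≢ : ∀ {K c} → ProperColumn K c → ∀ {b b′} → b ≢ b′ → entry c b ≢ entry c b′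
proper-entries-≢ _               {false} {false} b≢b′ = ⊥-elim (b≢b′ refl)
proper-entries-≢ (_ , _ , a≢b)   {false} {true}  _    = a≢b
proper-entries-≢ (_ , _ , a≢b)   {true}  {false} _    = a≢b ∘ sym
proper-entries-≢ _               {true}  {true}  b≢b′ = ⊥-elim (b≢b′ refl)

module _ {N} .{{_ : NonZero N}} (h : 3 ≤ N) where
  open Cycle N
  open Ladder N h

  columnsApart-entries : ∀ {d c c′} b b′ → ColumnsApart d c c′ →
    entry c b ≡ entry c′ b′ → entry c b < rowDist b b′ + d
  columnsApart-entries false false (aa , _  , _  , _ ) = aa
  columnsApart-entries true  true  (_  , bb , _  , _ ) = bb
  columnsApart-entries false true  (_  , _  , ab , _ ) = ab
  columnsApart-entries true  false (_  , _  , _  , ba) = ba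

  columnColouring : ∀ {K} (col : Fin N → Column) → (∀ i → ProperColumn K (col i)) →
    (∀ i {t} → 0 < t → t < N → t ≤ K → ColumnsApart t (col i) (col (shift i t))) → PackingColouring (CL N h) K
  columnColouring {K} col proper apart = record { π = π ; range = range ; packing = packing }
    where
    π : Fin N × Bool → ℕ
    π (i , b) = entry (col i) b

    range : ∀ v → 1 ≤ π v × π v ≤ K
    range (i , false) = proj₁ (proper i)
    range (i , true)  = proj₁ (proj₂ (proper i))

    nearby : ∀ {i b j c} s → s < N → shift i s ≡ j →
      (i , b) ≢ (j , c) → π (i , b) ≡ π (j , c) → π (i , b) < rowDist b c + s
    nearby zero _ refl u≢v same = ⊥-elim (proper-entries-≢ (proper _) (u≢v ∘ cong (_ ,_)) same)
    nearby {i} {b} {c = c} s@(suc _) s<N refl _ same with s ≤? K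
    ... | yes s≤K = columnsApart-entries b c (apart i (s≤s z≤n) s<N s≤K) same
    ... | no  s≰K = ≤-<-trans (proj₂ (range (i , b))) (<-≤-trans (≰⇒> s≰K) (m≤n+m s (rowDist b c)))

    -- A walk may wind around the cycle; only its offset modulo N matters.
    within : ∀ {i b j c} t → shift i t ≡ j →
      (i , b) ≢ (j , c) → π (i , b) ≡ π (j , c) → π (i , b) < rowDist b c + t
    within {i} {b} {c = c} t p u≢v same =
      <-≤-trans (nearby (t % N) (m%n<n t N) (trans (shift-% i t) p) u≢v same) (+-monoʳ-≤ (rowDist b c) (m%n≤m t N))

    packing : ∀ u v → u ≢ v → π u ≡ π v → DistGreater (CL N h) u v (π u)
    packing (i , b) (j , c) u≢v same k w with walk⇒offset w
    ... | t , bound , inj₁ p = <-≤-trans (within t p u≢v same) bound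
    ... | t , bound , inj₂ p =
      <-≤-trans (subst₂ _<_ (sym same) (cong (_+ t) (rowDist-sym c b)) (within t p (u≢v ∘ sym) (sym same))) bound

nth : List Column → ℕ → Column
nth []      _       = 0 , 0
nth (c ∷ _) zero    = c
nth (_ ∷ w) (suc x) = nth w x

nth-++ˡ : ∀ u {v x} → x < length u → nth (u ++ v) x ≡ nth u x
nth-++ˡ (c ∷ u) {x = zero}  _         = refl
nth-++ˡ (c ∷ u) {x = suc x} (s≤s x<u) = nth-++ˡ u x<u

nth-++ʳ : ∀ u {v} x → nth (u ++ v) (length u + x) ≡ nth v x
nth-++ʳ []      x = refl
nth-++ʳ (c ∷ u) x = nth-++ʳ u x

nth-All : ∀ {P : Column → Set} {w x} → All P w → x < length w → P (nth w x)
nth-All {x = zero}  (p ∷ _)  _         = p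
nth-All {x = suc x} (_ ∷ ps) (s≤s x<w) = nth-All ps x<w

ApartWindow : ℕ → List Column → ℕ → Set
ApartWindow K u x = ∀ {t} → t < K → ColumnsApart (suc t) (nth u x) (nth u (x + suc t))

-- P is the block the cyclic word starts with, so w ++ P contains every window of the cyclic word
-- that starts in w.
Windowed : ℕ → List Column → List Column → Set
Windowed K P w = ∀ {x} → x < length w → ApartWindow K (w ++ P) x

windowed? : ∀ K P w → Dec (Windowed K P w)
windowed? K P w = allUpTo? (λ x → allUpTo? (λ t →
  columnsApart? (suc t) (nth (w ++ P) x) (nth (w ++ P) (x + suc t))) K) (length w)

apartWindow-++ˡ : ∀ {K u x} v → x + K < length u → ApartWindow K u x → ApartWindow K (u ++ v) x
apartWindow-++ˡ {K} {u} {x} v x+K<u apart {t} t<K =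
  subst₂ (ColumnsApart (suc t)) (sym (nth-++ˡ u (≤-<-trans (m≤m+n x K) x+K<u)))
    (sym (nth-++ˡ u (≤-<-trans (+-monoʳ-≤ x t<K) x+K<u))) (apart t<K)

apartWindow-++ʳ : ∀ {K v y} u → ApartWindow K v y → ApartWindow K (u ++ v) (length u + y)
apartWindow-++ʳ {v = v} {y} u apart {t} t<K =
  subst₂ (ColumnsApart (suc t)) (sym (nth-++ʳ u y))
    (sym (trans (cong (nth (u ++ v)) (+-assoc (length u) y (suc t))) (nth-++ʳ u (y + suc t)))) (apart t<K)

windowed-++ : ∀ {K P u v} → K ≤ length P → Windowed K P u → Windowed K P (P ++ v) → Windowed K P (u ++ P ++ v)
windowed-++ {K} {P} {u} {v} K≤P windowed-u windowed-Pv {x} x<uPv with x <? length u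
... | yes x<u = subst (λ w → ApartWindow K w x) regroup
  (apartWindow-++ˡ {u = u ++ P} (v ++ P) x+K<uP (windowed-u x<u))
  where
  x+K<uP : x + K < length (u ++ P)
  x+K<uP = subst (x + K <_) (sym (length-++ u)) (+-mono-<-≤ x<u K≤P)
  regroup : (u ++ P) ++ v ++ P ≡ (u ++ P ++ v) ++ P
  regroup = trans (++-assoc u P (v ++ P)) (trans (cong (u ++_) (sym (++-assoc P v P))) (sym (++-assoc u (P ++ v) P)))
... | no  x≮u = subst₂ (ApartWindow K) (sym (++-assoc u (P ++ v) P)) (m+[n∸m]≡n u≤x)
  (apartWindow-++ʳ u (windowed-Pv y<Pv))
  where
  u≤x : length u ≤ x
  u≤x = ≮⇒≥ x≮u
  y<Pv : x ∸ length u < length (P ++ v)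
  y<Pv = +-cancelˡ-< (length u) _ _ (subst₂ _<_ (sym (m+[n∸m]≡n u≤x)) (length-++ u) x<uPv)

windowed-periodic : ∀ {K} P v → K ≤ length P → Windowed K P P → Windowed K P (P ++ v) →
  ∀ k → Windowed K P (P ++ fold v (P ++_) k)
windowed-periodic P v K≤P periodic base zero    = base
windowed-periodic P v K≤P periodic base (suc k) =
  windowed-++ {u = P} {fold v (P ++_) k} K≤P periodic (windowed-periodic P v K≤P periodic base k)

length-periodic : ∀ (P v : List Column) k → length (P ++ fold v (P ++_) k) ≡ length (P ++ v) + k * length P
length-periodic P v zero    = sym (+-identityʳ _)
length-periodic P v (suc k) = begin
  length (P ++ P ++ fold v (P ++_) k)       ≡⟨ length-++ P ⟩
  p + length (P ++ fold v (P ++_) k)        ≡⟨ cong (p +_) (length-periodic P v k) ⟩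
  p + (length (P ++ v) + k * p)             ≡⟨ +-assoc p _ _ ⟨
  p + length (P ++ v) + k * p               ≡⟨ cong (_+ k * p) (+-comm p _) ⟩
  length (P ++ v) + p + k * p               ≡⟨ +-assoc (length (P ++ v)) p _ ⟩
  length (P ++ v) + (p + k * p)             ∎
  where
  open ≡-Reasoning
  p = length P

All-periodic : ∀ {Q : Column → Set} {P v} → All Q P → All Q v → ∀ k → All Q (fold v (P ++_) k)
All-periodic QP Qv zero    = Qv
All-periodic QP Qv (suc k) = ++⁺ QP (All-periodic QP Qv k)

module Words (N : ℕ) .{{_ : NonZero N}} (h : 3 ≤ N) where
  open Cycle N

  CyclicallyApart : ℕ → List Column → Set
  CyclicallyApart K w = ∀ {x} → x < N → ∀ {t} → t < K → suc t < N →
    ColumnsApart (suc t) (nth w x) (nth w ((x + suc t) % N))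

  cyclicallyApart? : ∀ K w → Dec (CyclicallyApart K w)
  cyclicallyApart? K w = allUpTo? (λ x → allUpTo? (λ t →
    suc t <? N →-dec columnsApart? (suc t) (nth w x) (nth w ((x + suc t) % N))) K) N

  wordColouring : ∀ {K} w → length w ≡ N → All (ProperColumn K) w → CyclicallyApart K w →
    PackingColouring (CL N h) K
  wordColouring w refl proper apart = columnColouring h (λ i → nth w (toℕ i)) (λ i → nth-All proper (toℕ<n i))
    λ { i {suc t} (s≤s z≤n) 1+t<N 1+t≤K →
      subst (ColumnsApart (suc t) (nth w (toℕ i)) ∘ nth w) (sym (toℕ-shift i (suc t)))
        (apart (toℕ<n i) 1+t≤K 1+t<N) }

  windowed⇒cyclicallyApart : ∀ {K} P v → K ≤ length P → length (P ++ v) ≡ N →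
    Windowed K P (P ++ v) → CyclicallyApart K (P ++ v)
  windowed⇒cyclicallyApart {K} P v K≤P refl windowed {x} x<N {t} t<K 1+t<N =
    subst₂ (ColumnsApart (suc t)) (nth-++ˡ w x<N) wraps (windowed x<N t<K)
    where
    w = P ++ v
    wraps : nth (w ++ P) (x + suc t) ≡ nth w ((x + suc t) % length w)
    wraps with x + suc t <? length w
    ... | yes inside = trans (nth-++ˡ w inside) (cong (nth w) (sym (m<n⇒m%n≡m inside)))
    ... | no  outside = begin
      nth (w ++ P) (x + suc t)             ≡⟨ cong (nth (w ++ P)) (m+[n∸m]≡n w≤x+1+t) ⟨
      nth (w ++ P) (length w + z)          ≡⟨ nth-++ʳ w z ⟩
      nth P z                              ≡⟨ nth-++ˡ P (<-≤-trans z<1+t (≤-trans t<K K≤P)) ⟨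
      nth w z                              ≡⟨ cong (nth w) z≡[x+1+t]%w ⟨
      nth w ((x + suc t) % length w)       ∎
      where
      open ≡-Reasoning
      w≤x+1+t = ≮⇒≥ outside
      z = x + suc t ∸ length w
      z<1+t : z < suc t
      z<1+t = +-cancelʳ-< (length w) z (suc t)
        (subst₂ _<_ (sym (m∸n+n≡m w≤x+1+t)) (+-comm (length w) (suc t)) (+-monoˡ-< (suc t) x<N))
      z≡[x+1+t]%w : (x + suc t) % length w ≡ z
      z≡[x+1+t]%w = trans (sym (m≤n⇒[n∸m]%m≡n%m w≤x+1+t)) (m<n⇒m%n≡m (<-trans z<1+t 1+t<N))

  periodicColouring : ∀ {K} P v → K ≤ length P → All (ProperColumn K) (P ++ v) →
    Windowed K P P → Windowed K P (P ++ v) →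
    ∀ k → N ≡ length (P ++ v) + k * length P → PackingColouring (CL N h) K
  periodicColouring P v K≤P proper periodic base k N≡ =
    wordColouring (P ++ fold v (P ++_) k) length≡N
      (++⁺ properP (All-periodic properP (++⁻ʳ P proper) k))
      (windowed⇒cyclicallyApart P (fold v (P ++_) k) K≤P length≡N (windowed-periodic P v K≤P periodic base k))
    where
    properP = ++⁻ˡ P proper
    length≡N = trans (length-periodic P v k) (sym N≡)

packingColouring-mono : ∀ {G k m} → PackingColouring G k → k ≤ m → PackingColouring G m
packingColouring-mono κ k≤m = record
  { π       = π
  ; range   = λ v → proj₁ (range v) , ≤-trans (proj₂ (range v)) k≤m
  ; packing = packing }
  where open PackingColouring κ

χ-intro : ∀ {G m} → PackingColouring G (suc m) → ¬ PackingColouring G m → PackingChromaticNumberIs G (suc m)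
χ-intro κ ¬κ = κ , λ k κ′ → ≮⇒≥ λ k<1+m → ¬κ (packingColouring-mono κ′ (≤-pred k<1+m))

phase : Column → Bool
phase (a , b) =
  if a ≡ᵇ 1 then false else if b ≡ᵇ 1 then true else
  if a ≡ᵇ 2 then false else if b ≡ᵇ 2 then true else
  if a ≡ᵇ 5 then false else true

no-4-colouring : ∀ n (h : 3 ≤ n) → ¬ PackingColouring (CL n h) 4
no-4-colouring 1 (s≤s ())
no-4-colouring 2 (s≤s (s≤s ()))
no-4-colouring 3 h = cycle-obstruction h refl
no-4-colouring 4 h = cycle-obstruction h refl
no-4-colouring 5 h = cycle-obstruction h refl
no-4-colouring (suc (suc (suc (suc (suc (suc n)))))) h = window-obstruction h (m≤m+n 6 n) refl

no-5-colouring-odd : ∀ n (h : 3 ≤ n) → 6 ≤ n → n % 2 ≡ 1 → ¬ PackingColouring (CL n h) 5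
no-5-colouring-odd (suc n) h 6≤n odd = parity-obstruction h phase 6≤n odd refl

no-4+n%2-colouring : ∀ n (h : 3 ≤ n) → 6 ≤ n → ¬ PackingColouring (CL n h) (4 + n % 2)
no-4+n%2-colouring n h 6≤n with n % 2 in parity | m%n<n n 2
... | 0           | _                = no-4-colouring n h
... | 1           | _                = no-5-colouring-odd n h 6≤n parity
... | suc (suc _) | s≤s (s≤s ())

χCL-large : ∀ m → χCL (15 + m) ≡ 5 + (15 + m) % 2
χCL-large m with (15 + m) % 2 | m%n<n (15 + m) 2
... | 0           | _ = refl
... | 1           | _ = refl
... | suc (suc _) | s≤s (s≤s ())

[m+k*6]%2≡m%2 : ∀ m k → (m + k * 6) % 2 ≡ m % 2
[m+k*6]%2≡m%2 m k = trans (cong (λ x → (m + x) % 2) (sym (*-assoc k 3 2))) ([m+kn]%n≡m%n m (k * 3) 2)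

χ-large : ∀ b k {m} (h : 3 ≤ 15 + m) → 15 + m ≡ b + k * 6 →
  PackingColouring (CL (15 + m) h) (5 + b % 2) → PackingChromaticNumberIs (CL (15 + m) h) (χCL (15 + m))
χ-large b k {m} h n≡ κ rewrite χCL-large m =
  χ-intro (subst (PackingColouring (CL (15 + m) h)) (cong (5 +_) parity) κ)
    (no-4+n%2-colouring (15 + m) h (m≤m+n 6 (9 + m)))
  where
  parity : b % 2 ≡ (15 + m) % 2
  parity = sym (trans (cong (_% 2) n≡) ([m+k*6]%2≡m%2 b k))

checkedWordColouring : ∀ {N} .{{_ : NonZero N}} (h : 3 ≤ N) K w → length w ≡ N →
  {True (all? (properColumn? K) w)} → {True (Words.cyclicallyApart? N h K w)} → PackingColouring (CL N h) K
checkedWordColouring {N} h K w len {proper} {apart} = Words.wordColouring N h w len (toWitness proper) (toWitness apart)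

period : List Column
period = (1 , 2) ∷ (3 , 1) ∷ (1 , 4) ∷ (2 , 1) ∷ (1 , 3) ∷ (5 , 1) ∷ []

checkedPeriodicColouring : ∀ {N} .{{_ : NonZero N}} (h : 3 ≤ N) v → let K = 5 + length v % 2 in
  {True (all? (properColumn? K) (period ++ v))} → {True (windowed? K period period)} →
  {True (windowed? K period (period ++ v))} → ∀ k → N ≡ length (period ++ v) + k * 6 → PackingColouring (CL N h) K
checkedPeriodicColouring {N} h v {proper} {periodic} {base} =
  Words.periodicColouring N h period v (+-monoʳ-≤ 5 (≤-pred (m%n<n (length v) 2)))
    (toWitness proper) (toWitness periodic) (toWitness base)

decade tail₅ tail₇ tail₉ : List Column
decade = (1 , 2) ∷ (3 , 1) ∷ (1 , 4) ∷ (2 , 1) ∷ (1 , 5) ∷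
         (3 , 1) ∷ (1 , 2) ∷ (4 , 1) ∷ (1 , 3) ∷ (5 , 1) ∷ []
tail₅  = (1 , 2) ∷ (3 , 1) ∷ (1 , 4) ∷ (2 , 1) ∷ (6 , 5) ∷ []
tail₇  = (1 , 6) ∷ (3 , 1) ∷ (1 , 2) ∷ (4 , 1) ∷ (1 , 3) ∷ (2 , 1) ∷ (6 , 5) ∷ []
tail₉  = (1 , 2) ∷ (4 , 1) ∷ (1 , 6) ∷ (2 , 1) ∷ (3 , 5) ∷ (1 , 2) ∷ (4 , 1) ∷ (1 , 3) ∷ (6 , 1) ∷ []

ladder₃ ladder₄ ladder₅ ladder₇ ladder₈ ladder₉ ladder₁₄ : List Column
ladder₃  = (1 , 2) ∷ (3 , 1) ∷ (4 , 5) ∷ []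
ladder₄  = (1 , 2) ∷ (3 , 1) ∷ (1 , 4) ∷ (5 , 1) ∷ []
ladder₅  = (1 , 2) ∷ (3 , 1) ∷ (1 , 4) ∷ (2 , 1) ∷ (5 , 6) ∷ []
ladder₇  = period ++ (6 , 7) ∷ []
ladder₈  = period ++ (1 , 6) ∷ (7 , 1) ∷ []
ladder₉  = period ++ (1 , 2) ∷ (4 , 1) ∷ (6 , 7) ∷ []
ladder₁₄ = period ++ (1 , 6) ∷ (2 , 1) ∷ (1 , 3) ∷ (4 , 1) ∷ (1 , 2) ∷ (3 , 1) ∷ (1 , 5) ∷ (6 , 1) ∷ []

χ-circularLadder : ∀ r q (h : 3 ≤ r + q * 6) → r < 6 →
  PackingChromaticNumberIs (CL (r + q * 6) h) (χCL (r + q * 6))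
χ-circularLadder 0 0 () _
χ-circularLadder 0 1 h _ = χ-intro (checkedPeriodicColouring h [] 0 refl) (no-4-colouring 6 h)
χ-circularLadder 0 2 h _ = χ-intro (checkedPeriodicColouring h [] 1 refl) (no-4-colouring 12 h)
χ-circularLadder 0 (suc (suc (suc k))) h _ = χ-large 6 (2 + k) h refl (checkedPeriodicColouring h [] (2 + k) refl)
χ-circularLadder 1 0 (s≤s ()) _
χ-circularLadder 1 1 h _ =
  χ-intro (checkedWordColouring h 7 ladder₇ refl)
    (top-colour-obstruction h refl (no-5-colouring-odd 7 h (m≤m+n 6 1) refl))
χ-circularLadder 1 2 h _ = χ-intro (checkedPeriodicColouring h tail₇ 0 refl) (no-5-colouring-odd 13 h (m≤m+n 6 7) refl)
χ-circularLadder 1 (suc (suc (suc k))) h _ = χ-large 13 (suc k) h refl (checkedPeriodicColouring h tail₇ (suc k) refl)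
χ-circularLadder 2 0 (s≤s (s≤s ())) _
χ-circularLadder 2 1 h _ =
  χ-intro (checkedWordColouring h 7 ladder₈ refl)
    (top-colour-obstruction h refl (top-colour-obstruction h refl (no-4-colouring 8 h)))
χ-circularLadder 2 2 h _ =
  χ-intro (checkedWordColouring h 6 ladder₁₄ refl) (top-colour-obstruction h refl (no-4-colouring 14 h))
χ-circularLadder 2 3 h _ = χ-intro (checkedWordColouring h 5 (decade ++ decade) refl) (no-4-colouring 20 h)
χ-circularLadder 2 (suc (suc (suc (suc k)))) h _ =
  χ-large 26 k h refl (checkedPeriodicColouring h (decade ++ decade) k refl)
χ-circularLadder 3 0 h _ = χ-intro (checkedWordColouring h 5 ladder₃ refl) (no-4-colouring 3 h)
χ-circularLadder 3 1 h _ =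
  χ-intro (checkedWordColouring h 7 ladder₉ refl)
    (top-colour-obstruction h refl (no-5-colouring-odd 9 h (m≤m+n 6 3) refl))
χ-circularLadder 3 (suc (suc k)) h _ = χ-large 15 k h refl (checkedPeriodicColouring h tail₉ k refl)
χ-circularLadder 4 0 h _ = χ-intro (checkedWordColouring h 5 ladder₄ refl) (no-4-colouring 4 h)
χ-circularLadder 4 1 h _ = χ-intro (checkedWordColouring h 5 decade refl) (no-4-colouring 10 h)
χ-circularLadder 4 (suc (suc k)) h _ = χ-large 16 k h refl (checkedPeriodicColouring h decade k refl)
χ-circularLadder 5 0 h _ = χ-intro (checkedWordColouring h 6 ladder₅ refl) (cycle-obstruction h refl)
χ-circularLadder 5 1 h _ =
  χ-intro (checkedPeriodicColouring h tail₅ 0 refl) (no-5-colouring-odd 11 h (m≤m+n 6 5) refl)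
χ-circularLadder 5 (suc (suc k)) h _ = χ-large 11 (suc k) h refl (checkedPeriodicColouring h tail₅ (suc k) refl)
χ-circularLadder (suc (suc (suc (suc (suc (suc _)))))) _ _ (s≤s (s≤s (s≤s (s≤s (s≤s (s≤s ()))))))

theorem7 : (n : ℕ) (h : 3 ≤ n) → PackingChromaticNumberIs (CL n h) (χCL n)
theorem7 n h with n % 6 | n / 6 | m%n<n n 6 | m≡m%n+[m/n]*n n 6
... | r | q | r<6 | refl = χ-circularLadder r q h r<6
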